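{- For any integers $r>s\ge1$, Pink's subgroup $G^{\mathrm{Pink}}_{r,s,\infty}$ is contained in $B_{r,s,\infty}$.
   Context: $T_\infty$ is the infinite binary rooted tree whose nodes are finite words in $\{a,b\}$ (root = empty word, $w$ joined to $wa,wb$), with automorphism group $\mathrm{Aut}(T_\infty)$ (profinite topology). For $\sigma\in\mathrm{Aut}(T_\infty)$ and a word $x$, $\mathrm{Par}(\sigma,x)\in\mathbb{Z}/2\mathbb{Z}$ is $0$ if $\sigma(xa)=\sigma(x)a$ and $1$ if $\sigma(xa)=\sigma(x)b$. $P^a_{r,s}(\sigma,x)=\sum_{w\in\{a,b\}^{r-1}}\mathrm{Par}(\sigma,xaw)+\sum_{w'\in\{a,b\}^{s-1}}\mathrm{Par}(\sigma,xbw')$, $P^b_{r,s}(\sigma,x)=\sum_{w\in\{a,b\}^{r-1}}\mathrm{Par}(\sigma,xbw)+\sum_{w'\in\{a,b\}^{s-1}}\mathrm{Par}(\sigma,xaw')$ in $\mathbb{Z}/2\mathbb{Z}$; $M_{r,s,\infty}$ = set of $\sigma$ such that all these values over all nodes coincide (common value $P_{r,s}(\sigma)$); $B_{r,s,\infty}=\{\sigma\in M_{r,s,\infty}:P_{r,s}(\sigma)=0\}$. Pink's group $G^{\mathrm{Pink}}_{r,s,\infty}$ is the closure of the subgroup generated by $\alpha_1,\dots,\alpha_r\in\mathrm{Aut}(T_\infty)$ defined by: for $1\le i\le s$, $\mathrm{Par}(\alpha_i,y)=1$ iff $y=a^{i-1}$; for $s<i\le r$, $\mathrm{Par}(\alpha_i,w)=1$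 iff $w=a^{i-s-1}(ba^{r-s-1})^na^s$ for some $n\ge0$ ($u^j$ = $j$ consecutive copies of the word $u$). Equivalently, $\alpha_1=\tau$ (swap at the root only), $\alpha_{s+1}=(\alpha_s,\alpha_r)$, $\alpha_i=(\alpha_{i-1},1)$ for $i\ne1,s+1$, where $(\alpha,\beta)$ fixes $a,b$ and acts as $\alpha$ on the subtree above $a$ and as $\beta$ on that above $b$. -}

module Defs where

open import Data.Bool using (Bool; true; false; _xor_)
open import Data.Nat using (ℕ; zero; suc; _∸_; _<_; _≤_)
open import Data.Fin using (Fin; toℕ)
open import Data.List using (List; []; _∷_; _++_; map; foldr; replicate; concat; length)
open import Data.Product using (Σ; ∃; _×_; _,_; proj₁)
open import Function.Bundles using (_⇔_)
open import Relation.Binary.PropositionalEquality using (_≡_)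

data Letter : Set where
  a b : Letter

-- Words (nodes of T_∞); the list is read left-to-right from the root,
-- so the paper's word "x a" is  x ++ (a ∷ []).
Word : Set
Word = List Letter

-- Z/2Z is represented by Bool (false = 0, true = 1, addition = xor).

-- An automorphism of T_∞ is represented by its portrait
-- x ↦ Par(σ, x)  (every such function determines a unique automorphism
-- and vice versa).  Par(σ,x) is then just  σ x.
Aut : Set
Aut = Word → Bool

Par : Aut → Word → Bool
Par σ x = σ x

flipL : Letter → Bool → Letter
flipL c false = c
flipL a true  = b
flipL b true  = a

-- the action of σ on words: σ(x c) = σ(x) (c + Par(σ,x))
act : Aut → Word → Word
act σ []      = []
act σ (c ∷ w) = flipL c (σ []) ∷ act (λ u → σ (c ∷ u)) w

actInv : Aut → Word → Word
actInv σ []      = []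
actInv σ (c ∷ w) = flipL c (σ []) ∷ actInv (λ u → σ (flipL c (σ []) ∷ u)) w

-- group structure: (σ ∘ τ)(x) = σ(τ(x))
idA : Aut
idA _ = false

_∘A_ : Aut → Aut → Aut
(σ ∘A τ) x = τ x xor σ (act τ x)

invA : Aut → Aut
invA σ x = σ (actInv σ x)

allWords : ℕ → List Word
allWords zero    = [] ∷ []
allWords (suc n) = map (a ∷_) (allWords n) ++ map (b ∷_) (allWords n)

sumPar : Aut → Word → ℕ → Bool
sumPar σ x n = foldr _xor_ false (map (λ w → Par σ (x ++ w)) (allWords n))

Pa : ℕ → ℕ → Aut → Word → Bool
Pa r s σ x = sumPar σ (x ++ (a ∷ [])) (r ∸ 1) xor sumPar σ (x ++ (b ∷ [])) (s ∸ 1)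

Pb : ℕ → ℕ → Aut → Word → Bool
Pb r s σ x = sumPar σ (x ++ (b ∷ [])) (r ∸ 1) xor sumPar σ (x ++ (a ∷ [])) (s ∸ 1)

-- M_{r,s,∞}: all values P^a_{r,s}(σ,x), P^b_{r,s}(σ,x) coincide;
-- the witness is the common value P_{r,s}(σ).
M : ℕ → ℕ → Aut → Set
M r s σ = Σ Bool λ c → (x : Word) → (Pa r s σ x ≡ c) × (Pb r s σ x ≡ c)

B : ℕ → ℕ → Aut → Set
B r s σ = Σ (M r s σ) λ m → proj₁ m ≡ false

-- Pink's generators α_1..α_r (α (k) is α_{k+1}), characterised by their parities
record IsPinkGenerators (r s : ℕ) (α : Fin r → Aut) : Set where
  field
    low  : (k : Fin r) → suc (toℕ k) ≤ s → (y : Word) →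
           (Par (α k) y ≡ true) ⇔ (y ≡ replicate (toℕ k) a)
    high : (k : Fin r) → s < suc (toℕ k) → (w : Word) →
           (Par (α k) w ≡ true) ⇔
           (∃ λ (n : ℕ) → w ≡ replicate (toℕ k ∸ s) a
                              ++ concat (replicate n (b ∷ replicate (r ∸ s ∸ 1) a))
                              ++ replicate s a)

-- evaluation of a word in the generators and their inverses
-- (true = inverse of the generator)
evalGen : {r : ℕ} → (Fin r → Aut) → List (Fin r × Bool) → Aut
evalGen α []                  = idA
evalGen α ((k , false) ∷ ws) = α k ∘A evalGen α ws
evalGen α ((k , true)  ∷ ws) = invA (α k) ∘A evalGen α ws

-- σ lies in the closure (profinite topology) of the subgroup generated by α:
-- for every level n some element of the subgroup agrees with σ on T_n,
-- i.e. has the same parities at all nodes of length < n.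
InClosure : {r : ℕ} → (Fin r → Aut) → Aut → Set
InClosure {r} α σ = (n : ℕ) → ∃ λ (ws : List (Fin r × Bool)) →
                    (x : Word) → length x < n → Par (evalGen α ws) x ≡ Par σ x

PinkGroup : (r s : ℕ) → (α : Fin r → Aut) → Aut → Set
PinkGroup r s α σ = InClosure α σ

module Submission where

-- Write P(σ, x, c) for P^c_{r,s}(σ, x). Each of its two sums runs over a full level of a
-- subtree, and an automorphism τ merely permutes such a level; hence
--   P(σ ∘ τ, x, c) = P(τ, x, c) + P(σ, τ(x), c + Par(τ, x)),
-- so the automorphisms at which every P vanishes form a group. Every generator lies in it:
-- for i ≤ s the one nontrivial parity of α_i is too shallow to occur in any sum, and for
-- i > s all summands vanish except α_i(x b a^{r-1}) and α_i(x a^s), which are equal because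
-- x b a^{r-1} lies in the support of α_i exactly when x a^s does. Finally P(σ, x, c) only
-- sees σ on the first |x| + r levels, so the property passes to the closure.

open import Defs
open import Algebra.Bundles using (CommutativeRing)
open import Data.Bool using (Bool; true; false; _xor_)
open import Data.Bool.Properties
  using (xor-∧-commutativeRing; xor-assoc; xor-comm; xor-identityʳ; xor-same; ¬-not)
open import Algebra.Properties.CommutativeSemigroup
  (CommutativeRing.+-commutativeSemigroup xor-∧-commutativeRing) using () renaming (interchange to xor-interchange)
open import Data.Fin using (Fin; toℕ)
open import Data.Fin.Properties using (toℕ<n)
open import Data.List using (List; []; _∷_; _++_; map; foldr; replicate; concat; length)
open import Data.List.Properties
  using (map-++; map-∘; length-++; length-replicate; ++-assoc; ++-identityʳ; ∷-injective; ∷-injectiveʳ)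
open import Data.Nat using (ℕ; zero; suc; _+_; _∸_; _≤_; _<_; s≤s; _≤?_)
open import Data.Nat.Properties
  using (≤-refl; ≤-trans; ≤-reflexive; ≤-pred; <⇒≤; <⇒≱; ≰⇒>; m≤n+m; +-monoʳ-≤; +-comm;
         +-cancelʳ-≡; ∸-monoˡ-≤; ∸-+-assoc; m∸n+n≡m; <-irrefl; suc-injective)
open import Data.Product using (∃; _×_; _,_; proj₂)
open import Function.Bundles using (_⇔_; mk⇔; Equivalence)
open import Relation.Nullary using (yes; no; contradiction)
open import Relation.Binary.PropositionalEquality
  using (_≡_; _≢_; refl; sym; trans; cong; cong₂; module ≡-Reasoning)

open ≡-Reasoning

≡true⇔⇒≡ : ∀ {p q : Bool} → (p ≡ true ⇔ q ≡ true) → p ≡ q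
≡true⇔⇒≡ {false} {false} _   = refl
≡true⇔⇒≡ {false} {true}  p⇔q = Equivalence.from p⇔q refl
≡true⇔⇒≡ {true}  {_}     p⇔q = sym (Equivalence.to p⇔q refl)

b∷≢a∷ : ∀ {u v : Word} → b ∷ u ≢ a ∷ v
b∷≢a∷ ()

a∷≢b∷ : ∀ {u v : Word} → a ∷ u ≢ b ∷ v
a∷≢b∷ ()

++-cancel-length : ∀ {A : Set} (u v u′ v′ : List A) →
                   length v ≡ length v′ → u ++ v ≡ u′ ++ v′ → u ≡ u′ × v ≡ v′
++-cancel-length u v u′ v′ |v|≡|v′| eq = go u u′ |u|≡|u′| eq
  where
  |u|≡|u′| : length u ≡ length u′
  |u|≡|u′| = +-cancelʳ-≡ _ _ _ (begin
    length u + length v   ≡⟨ sym (length-++ u) ⟩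
    length (u ++ v)       ≡⟨ cong length eq ⟩
    length (u′ ++ v′)     ≡⟨ length-++ u′ ⟩
    length u′ + length v′ ≡⟨ cong (length u′ +_) (sym |v|≡|v′|) ⟩
    length u′ + length v  ∎)
  go : ∀ u u′ → length u ≡ length u′ → u ++ v ≡ u′ ++ v′ → u ≡ u′ × v ≡ v′
  go []      []        _ eq = refl , eq
  go (c ∷ u) (c′ ∷ u′) l eq with ∷-injective eq
  ... | refl , eq′ with go u u′ (suc-injective l) eq′
  ...   | refl , v≡v′ = refl , v≡v′

replicate-+ : ∀ {A : Set} m n (c : A) → replicate m c ++ replicate n c ≡ replicate (m + n) c
replicate-+ zero    n c = refl
replicate-+ (suc m) n c = cong (c ∷_) (replicate-+ m n c)

concat-replicate-suc : ∀ {A : Set} n (u : List A) →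
                       concat (replicate (suc n) u) ≡ concat (replicate n u) ++ u
concat-replicate-suc zero    u = ++-identityʳ u
concat-replicate-suc (suc n) u = begin
  u ++ concat (replicate (suc n) u)   ≡⟨ cong (u ++_) (concat-replicate-suc n u) ⟩
  u ++ (concat (replicate n u) ++ u)  ≡⟨ sym (++-assoc u _ u) ⟩
  (u ++ concat (replicate n u)) ++ u  ∎

levelSum : (Word → Bool) → ℕ → Bool
levelSum f zero    = f []
levelSum f (suc k) = levelSum (λ w → f (a ∷ w)) k xor levelSum (λ w → f (b ∷ w)) k

foldr-xor-++ : ∀ xs ys →
  foldr _xor_ false (xs ++ ys) ≡ foldr _xor_ false xs xor foldr _xor_ false ys
foldr-xor-++ []       ys = refl
foldr-xor-++ (x ∷ xs) ys = trans (cong (x xor_) (foldr-xor-++ xs ys)) (sym (xor-assoc x _ _))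

foldr-xor-allWords : ∀ f k → foldr _xor_ false (map f (allWords k)) ≡ levelSum f k
foldr-xor-allWords f zero    = xor-identityʳ (f [])
foldr-xor-allWords f (suc k) = begin
  Σ (map f (map (a ∷_) W ++ map (b ∷_) W))
    ≡⟨ cong Σ (map-++ f (map (a ∷_) W) (map (b ∷_) W)) ⟩
  Σ (map f (map (a ∷_) W) ++ map f (map (b ∷_) W))
    ≡⟨ foldr-xor-++ (map f (map (a ∷_) W)) _ ⟩
  Σ (map f (map (a ∷_) W)) xor Σ (map f (map (b ∷_) W))
    ≡⟨ cong₂ _xor_ (cong Σ (sym (map-∘ W))) (cong Σ (sym (map-∘ W))) ⟩
  Σ (map (λ w → f (a ∷ w)) W) xor Σ (map (λ w → f (b ∷ w)) W)
    ≡⟨ cong₂ _xor_ (foldr-xor-allWords _ k) (foldr-xor-allWords _ k) ⟩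
  levelSum f (suc k) ∎
  where
  Σ = foldr _xor_ false
  W = allWords k

sumPar≡levelSum : ∀ σ x k → sumPar σ x k ≡ levelSum (λ w → σ (x ++ w)) k
sumPar≡levelSum σ x = foldr-xor-allWords (λ w → σ (x ++ w))

levelSum-cong : ∀ {f g} k → (∀ w → length w ≡ k → f w ≡ g w) → levelSum f k ≡ levelSum g k
levelSum-cong zero    f≡g = f≡g [] refl
levelSum-cong (suc k) f≡g = cong₂ _xor_ (levelSum-cong k λ w l → f≡g (a ∷ w) (cong suc l))
                                        (levelSum-cong k λ w l → f≡g (b ∷ w) (cong suc l))

sumPar-snoc : ∀ σ x c k → sumPar σ (x ++ c ∷ []) k ≡ levelSum (λ w → σ (x ++ c ∷ w)) k
sumPar-snoc σ x c k = trans (sumPar≡levelSum σ (x ++ c ∷ []) k)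
                            (levelSum-cong k λ w _ → cong σ (++-assoc x (c ∷ []) w))

levelSum-vanishes : ∀ f k → (∀ w → length w ≡ k → f w ≡ false) → levelSum f k ≡ false
levelSum-vanishes f zero    f≡0 = f≡0 [] refl
levelSum-vanishes f (suc k) f≡0 =
  cong₂ _xor_ (levelSum-vanishes _ k λ w l → f≡0 (a ∷ w) (cong suc l))
              (levelSum-vanishes _ k λ w l → f≡0 (b ∷ w) (cong suc l))

levelSum-single : ∀ f w₀ {k} → length w₀ ≡ k →
                  (∀ w → length w ≡ k → f w ≡ true → w ≡ w₀) → levelSum f k ≡ f w₀
levelSum-single f []       refl _       = refl
levelSum-single f (a ∷ w₀) refl only-w₀ =
  trans (cong₂ _xor_ (levelSum-single _ w₀ refl λ w l t → ∷-injectiveʳ (only-w₀ (a ∷ w) (cong suc l) t))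
                     (levelSum-vanishes _ _ λ w l → ¬-not λ t → b∷≢a∷ (only-w₀ (b ∷ w) (cong suc l) t)))
        (xor-identityʳ _)
levelSum-single f (b ∷ w₀) refl only-w₀ =
  cong₂ _xor_ (levelSum-vanishes _ _ λ w l → ¬-not λ t → a∷≢b∷ (only-w₀ (a ∷ w) (cong suc l) t))
              (levelSum-single _ w₀ refl λ w l t → ∷-injectiveʳ (only-w₀ (b ∷ w) (cong suc l) t))

levelSum-xor : ∀ f g k → levelSum (λ w → f w xor g w) k ≡ levelSum f k xor levelSum g k
levelSum-xor f g zero    = refl
levelSum-xor f g (suc k) =
  trans (cong₂ _xor_ (levelSum-xor (λ w → f (a ∷ w)) (λ w → g (a ∷ w)) k)
                     (levelSum-xor (λ w → f (b ∷ w)) (λ w → g (b ∷ w)) k))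
        (xor-interchange (levelSum (λ w → f (a ∷ w)) k) (levelSum (λ w → g (a ∷ w)) k)
                         (levelSum (λ w → f (b ∷ w)) k) (levelSum (λ w → g (b ∷ w)) k))

levelSum-act : ∀ τ g k → levelSum (λ w → g (act τ w)) k ≡ levelSum g k
levelSum-act τ g zero    = refl
levelSum-act τ g (suc k) with τ []
... | false = cong₂ _xor_ (levelSum-act (λ u → τ (a ∷ u)) (λ w → g (a ∷ w)) k)
                          (levelSum-act (λ u → τ (b ∷ u)) (λ w → g (b ∷ w)) k)
... | true  = trans (cong₂ _xor_ (levelSum-act (λ u → τ (a ∷ u)) (λ w → g (b ∷ w)) k)
                                 (levelSum-act (λ u → τ (b ∷ u)) (λ w → g (a ∷ w)) k))
                    (xor-comm (levelSum (λ w → g (b ∷ w)) k) (levelSum (λ w → g (a ∷ w)) k))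

act-++ : ∀ τ y w → act τ (y ++ w) ≡ act τ y ++ act (λ u → τ (y ++ u)) w
act-++ τ []      w = refl
act-++ τ (c ∷ y) w = cong (flipL c (τ []) ∷_) (act-++ (λ u → τ (c ∷ u)) y w)

act-snoc : ∀ τ x c → act τ (x ++ c ∷ []) ≡ act τ x ++ flipL c (τ x) ∷ []
act-snoc τ []      c = refl
act-snoc τ (d ∷ x) c = cong (flipL d (τ []) ∷_) (act-snoc (λ u → τ (d ∷ u)) x c)

act-invA : ∀ τ w → act (invA τ) w ≡ actInv τ w
act-invA τ []      = refl
act-invA τ (c ∷ w) = cong (flipL c (τ []) ∷_) (act-invA (λ u → τ (flipL c (τ []) ∷ u)) w)

sumPar-act : ∀ σ τ y k → levelSum (λ w → σ (act τ (y ++ w))) k ≡ sumPar σ (act τ y) k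
sumPar-act σ τ y k = begin
  levelSum (λ w → σ (act τ (y ++ w))) k            ≡⟨ levelSum-cong k (λ w _ → cong σ (act-++ τ y w)) ⟩
  levelSum (λ w → σ (act τ y ++ act τ′ w)) k        ≡⟨ levelSum-act τ′ (λ v → σ (act τ y ++ v)) k ⟩
  levelSum (λ v → σ (act τ y ++ v)) k               ≡⟨ sym (sumPar≡levelSum σ (act τ y) k) ⟩
  sumPar σ (act τ y) k                              ∎
  where τ′ = λ u → τ (y ++ u)

sumPar-∘ : ∀ σ τ y k → sumPar (σ ∘A τ) y k ≡ sumPar τ y k xor sumPar σ (act τ y) k
sumPar-∘ σ τ y k = begin
  sumPar (σ ∘A τ) y k
    ≡⟨ sumPar≡levelSum (σ ∘A τ) y k ⟩
  levelSum (λ w → τ (y ++ w) xor σ (act τ (y ++ w))) k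
    ≡⟨ levelSum-xor (λ w → τ (y ++ w)) (λ w → σ (act τ (y ++ w))) k ⟩
  levelSum (λ w → τ (y ++ w)) k xor levelSum (λ w → σ (act τ (y ++ w))) k
    ≡⟨ cong₂ _xor_ (sym (sumPar≡levelSum τ y k)) (sumPar-act σ τ y k) ⟩
  sumPar τ y k xor sumPar σ (act τ y) k ∎

sumPar-invA : ∀ σ y k → sumPar (invA σ) y k ≡ sumPar σ (act (invA σ) y) k
sumPar-invA σ y k = begin
  sumPar (invA σ) y k                          ≡⟨ sumPar≡levelSum (invA σ) y k ⟩
  levelSum (λ w → σ (actInv σ (y ++ w))) k     ≡⟨ levelSum-cong k (λ w _ → cong σ (sym (act-invA σ (y ++ w)))) ⟩
  levelSum (λ w → σ (act (invA σ) (y ++ w))) k ≡⟨ sumPar-act σ (invA σ) y k ⟩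
  sumPar σ (act (invA σ) y) k                  ∎

-- P r s σ x a and P r s σ x b are, by definition, Pa r s σ x and Pb r s σ x.
P : ℕ → ℕ → Aut → Word → Letter → Bool
P r s σ x c = sumPar σ (x ++ c ∷ []) (r ∸ 1) xor sumPar σ (x ++ flipL c true ∷ []) (s ∸ 1)

Vanishes : ℕ → ℕ → Aut → Set
Vanishes r s σ = ∀ x c → P r s σ x c ≡ false

flipL-swap : ∀ c β → flipL (flipL c true) β ≡ flipL (flipL c β) true
flipL-swap a false = refl
flipL-swap a true  = refl
flipL-swap b false = refl
flipL-swap b true  = refl

P-twisted : ∀ r s σ z c β → P r s σ z (flipL c β) ≡
  sumPar σ (z ++ flipL c β ∷ []) (r ∸ 1) xor sumPar σ (z ++ flipL (flipL c true) β ∷ []) (s ∸ 1)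
P-twisted r s σ z c β =
  cong (λ d → sumPar σ (z ++ flipL c β ∷ []) (r ∸ 1) xor sumPar σ (z ++ d ∷ []) (s ∸ 1))
       (sym (flipL-swap c β))

P-∘ : ∀ r s σ τ x c → P r s (σ ∘A τ) x c ≡ P r s τ x c xor P r s σ (act τ x) (flipL c (τ x))
P-∘ r s σ τ x c = begin
  P r s (σ ∘A τ) x c
    ≡⟨ cong₂ _xor_ (split c (r ∸ 1)) (split (flipL c true) (s ∸ 1)) ⟩
  (S τ x c (r ∸ 1) xor S σ z (flipL c β) (r ∸ 1))
    xor (S τ x c′ (s ∸ 1) xor S σ z (flipL c′ β) (s ∸ 1))
    ≡⟨ xor-interchange (S τ x c (r ∸ 1)) _ (S τ x c′ (s ∸ 1)) _ ⟩
  P r s τ x c xor (S σ z (flipL c β) (r ∸ 1) xor S σ z (flipL c′ β) (s ∸ 1))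
    ≡⟨ cong (P r s τ x c xor_) (sym (P-twisted r s σ z c β)) ⟩
  P r s τ x c xor P r s σ z (flipL c β) ∎
  where
  S : Aut → Word → Letter → ℕ → Bool
  S ρ y d k = sumPar ρ (y ++ d ∷ []) k
  z = act τ x
  β = τ x
  c′ = flipL c true
  split : ∀ d k → S (σ ∘A τ) x d k ≡ S τ x d k xor S σ z (flipL d β) k
  split d k = trans (sumPar-∘ σ τ (x ++ d ∷ []) k)
                    (cong (λ y → S τ x d k xor sumPar σ y k) (act-snoc τ x d))

P-invA : ∀ r s σ x c → P r s (invA σ) x c ≡ P r s σ (act (invA σ) x) (flipL c (invA σ x))
P-invA r s σ x c = trans (cong₂ _xor_ (split c (r ∸ 1)) (split (flipL c true) (s ∸ 1)))
                         (sym (P-twisted r s σ (act (invA σ) x) c (invA σ x)))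
  where
  split : ∀ d k → sumPar (invA σ) (x ++ d ∷ []) k
                ≡ sumPar σ (act (invA σ) x ++ flipL d (invA σ x) ∷ []) k
  split d k = trans (sumPar-invA σ (x ++ d ∷ []) k) (cong (λ y → sumPar σ y k) (act-snoc (invA σ) x d))

Vanishes-idA : ∀ r s → Vanishes r s idA
Vanishes-idA r s x c = cong₂ _xor_ (vanish (x ++ c ∷ []) (r ∸ 1)) (vanish (x ++ flipL c true ∷ []) (s ∸ 1))
  where
  vanish : ∀ y k → sumPar idA y k ≡ false
  vanish y k = trans (sumPar≡levelSum idA y k) (levelSum-vanishes _ k λ _ _ → refl)

Vanishes-∘ : ∀ r s σ τ → Vanishes r s σ → Vanishes r s τ → Vanishes r s (σ ∘A τ)
Vanishes-∘ r s σ τ σ-van τ-van x c =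
  trans (P-∘ r s σ τ x c) (cong₂ _xor_ (τ-van x c) (σ-van (act τ x) (flipL c (τ x))))

Vanishes-invA : ∀ r s σ → Vanishes r s σ → Vanishes r s (invA σ)
Vanishes-invA r s σ σ-van x c =
  trans (P-invA r s σ x c) (σ-van (act (invA σ) x) (flipL c (invA σ x)))

Vanishes-evalGen : ∀ r s {n} (α : Fin n → Aut) → (∀ k → Vanishes r s (α k)) →
                   ∀ ws → Vanishes r s (evalGen α ws)
Vanishes-evalGen r s α α-van []                 = Vanishes-idA r s
Vanishes-evalGen r s α α-van ((k , false) ∷ ws) =
  Vanishes-∘ r s (α k) (evalGen α ws) (α-van k) (Vanishes-evalGen r s α α-van ws)
Vanishes-evalGen r s α α-van ((k , true)  ∷ ws) =
  Vanishes-∘ r s (invA (α k)) (evalGen α ws) (Vanishes-invA r s (α k) (α-van k))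
             (Vanishes-evalGen r s α α-van ws)

Vanishes-closed : ∀ r s σ → s ≤ r →
  (∀ n → ∃ λ τ → Vanishes r s τ × (∀ z → length z < n → τ z ≡ σ z)) → Vanishes r s σ
Vanishes-closed r s σ s≤r approx x c with approx (suc (length x + suc (r ∸ 1)))
... | τ , τ-van , τ≈σ = begin
  P r s σ x c ≡⟨ sym (cong₂ _xor_ (agree c ≤-refl) (agree (flipL c true) (∸-monoˡ-≤ 1 s≤r))) ⟩
  P r s τ x c ≡⟨ τ-van x c ⟩
  false       ∎
  where
  agree : ∀ d {k} → k ≤ r ∸ 1 → sumPar τ (x ++ d ∷ []) k ≡ sumPar σ (x ++ d ∷ []) k
  agree d {k} k≤ = begin
    sumPar τ (x ++ d ∷ []) k               ≡⟨ sumPar-snoc τ x d k ⟩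
    levelSum (λ w → τ (x ++ d ∷ w)) k      ≡⟨ levelSum-cong k (λ w |w|≡k → τ≈σ _ (s≤s (bound w |w|≡k))) ⟩
    levelSum (λ w → σ (x ++ d ∷ w)) k      ≡⟨ sym (sumPar-snoc σ x d k) ⟩
    sumPar σ (x ++ d ∷ []) k               ∎
    where
    bound : ∀ w → length w ≡ k → length (x ++ d ∷ w) ≤ length x + suc (r ∸ 1)
    bound w |w|≡k = ≤-trans (≤-reflexive (length-++ x))
                            (+-monoʳ-≤ (length x) (s≤s (≤-trans (≤-reflexive |w|≡k) k≤)))

Vanishes-shallow : ∀ r s σ t → t < s → s ≤ r → (∀ z → t < length z → σ z ≡ false) →
                   Vanishes r s σ
Vanishes-shallow r s σ t t<s s≤r deep x c =
  cong₂ _xor_ (beyond c (≤-trans t≤s∸1 (∸-monoˡ-≤ 1 s≤r))) (beyond (flipL c true) t≤s∸1)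
  where
  t≤s∸1 : t ≤ s ∸ 1
  t≤s∸1 = ∸-monoˡ-≤ 1 t<s
  beyond : ∀ d {k} → t ≤ k → sumPar σ (x ++ d ∷ []) k ≡ false
  beyond d {k} t≤k = trans (sumPar-snoc σ x d k) (levelSum-vanishes _ k λ w |w|≡k → deep _
    (≤-trans (s≤s (≤-trans t≤k (≤-reflexive (sym |w|≡k))))
             (≤-trans (m≤n+m _ (length x)) (≤-reflexive (sym (length-++ x))))))

-- support n = a^{i-s-1} (b a^{r-s-1})^n a^s is the support of the generator α_i with i = K + s + 1.
module HighGenerator (r′ s′ K : ℕ) (K+s≤r′ : K + suc s′ ≤ r′) where

  d : ℕ
  d = r′ ∸ s′ ∸ 1

  block : Word
  block = b ∷ replicate d a

  prefix : ℕ → Word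
  prefix n = replicate K a ++ concat (replicate n block)

  support : ℕ → Word
  support n = replicate K a ++ concat (replicate n block) ++ replicate (suc s′) a

  support≡ : ∀ n → support n ≡ prefix n ++ replicate (suc s′) a
  support≡ n = sym (++-assoc (replicate K a) _ _)

  d+s≡r′ : d + suc s′ ≡ r′
  d+s≡r′ = begin
    r′ ∸ s′ ∸ 1 + suc s′  ≡⟨ cong (_+ suc s′) (trans (∸-+-assoc r′ s′ 1) (cong (r′ ∸_) (+-comm s′ 1))) ⟩
    r′ ∸ suc s′ + suc s′  ≡⟨ m∸n+n≡m (≤-trans (m≤n+m (suc s′) K) K+s≤r′) ⟩
    r′                    ∎

  support-suc : ∀ n → support (suc n) ≡ prefix n ++ b ∷ replicate r′ a
  support-suc n = begin
    replicate K a ++ (block ++ C) ++ S   ≡⟨ cong (λ u → replicate K a ++ u ++ S) (concat-replicate-suc n block) ⟩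
    replicate K a ++ (C ++ block) ++ S   ≡⟨ cong (replicate K a ++_) (++-assoc C block S) ⟩
    replicate K a ++ C ++ block ++ S     ≡⟨ sym (++-assoc (replicate K a) C (block ++ S)) ⟩
    prefix n ++ b ∷ replicate d a ++ S   ≡⟨ cong (λ u → prefix n ++ b ∷ u) (replicate-+ d (suc s′) a) ⟩
    prefix n ++ b ∷ replicate (d + suc s′) a ≡⟨ cong (λ m → prefix n ++ b ∷ replicate m a) d+s≡r′ ⟩
    prefix n ++ b ∷ replicate r′ a       ∎
    where
    C = concat (replicate n block)
    S = replicate (suc s′) a

  long-window : ∀ x c w → length w ≡ r′ → ∀ n → x ++ c ∷ w ≡ support n →
                ∃ λ m → x ≡ prefix m × c ∷ w ≡ b ∷ replicate r′ a
  long-window x c w |w|≡r′ zero eq = contradiction too-long (<⇒≱ (s≤s (≤-trans short K+s≤r′)))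
    where
    too-long : suc r′ ≤ length (support zero)
    too-long = ≤-trans (≤-trans (s≤s (≤-reflexive (sym |w|≡r′))) (m≤n+m _ (length x)))
                       (≤-reflexive (trans (sym (length-++ x)) (cong length eq)))
    short : length (support zero) ≤ K + suc s′
    short = ≤-reflexive (trans (length-++ (replicate K a))
                               (cong₂ _+_ (length-replicate K) (length-replicate (suc s′))))
  long-window x c w |w|≡r′ (suc n) eq =
    n , ++-cancel-length x (c ∷ w) (prefix n) (b ∷ replicate r′ a)
          (cong suc (trans |w|≡r′ (sym (length-replicate r′)))) (trans eq (support-suc n))

  short-window : ∀ x c w → length w ≡ s′ → ∀ n → x ++ c ∷ w ≡ support n →
                 x ≡ prefix n × c ∷ w ≡ replicate (suc s′) a
  short-window x c w |w|≡s′ n eq =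
    ++-cancel-length x (c ∷ w) (prefix n) (replicate (suc s′) a)
      (cong suc (trans |w|≡s′ (sym (length-replicate s′)))) (trans eq (support≡ n))

  module _ (σ : Aut) (supp : ∀ w → (σ w ≡ true) ⇔ (∃ λ n → w ≡ support n)) (x : Word) where

    hit : ∀ c w → σ (x ++ c ∷ w) ≡ true → ∃ λ n → x ++ c ∷ w ≡ support n
    hit c w = Equivalence.to (supp (x ++ c ∷ w))

    long-a : levelSum (λ w → σ (x ++ a ∷ w)) r′ ≡ false
    long-a = levelSum-vanishes _ r′ λ w |w|≡r′ → ¬-not λ t →
      let n , eq = hit a w t in a∷≢b∷ (proj₂ (proj₂ (long-window x a w |w|≡r′ n eq)))

    short-b : levelSum (λ w → σ (x ++ b ∷ w)) s′ ≡ false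
    short-b = levelSum-vanishes _ s′ λ w |w|≡s′ → ¬-not λ t →
      let n , eq = hit b w t in b∷≢a∷ (proj₂ (short-window x b w |w|≡s′ n eq))

    long-b : levelSum (λ w → σ (x ++ b ∷ w)) r′ ≡ σ (x ++ b ∷ replicate r′ a)
    long-b = levelSum-single _ (replicate r′ a) (length-replicate r′) λ w |w|≡r′ t →
      let n , eq = hit b w t in ∷-injectiveʳ (proj₂ (proj₂ (long-window x b w |w|≡r′ n eq)))

    short-a : levelSum (λ w → σ (x ++ a ∷ w)) s′ ≡ σ (x ++ a ∷ replicate s′ a)
    short-a = levelSum-single _ (replicate s′ a) (length-replicate s′) λ w |w|≡s′ t →
      let n , eq = hit a w t in ∷-injectiveʳ (proj₂ (short-window x a w |w|≡s′ n eq))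

    long-b≡short-a : σ (x ++ b ∷ replicate r′ a) ≡ σ (x ++ a ∷ replicate s′ a)
    long-b≡short-a = ≡true⇔⇒≡ (mk⇔ to from)
      where
      to : σ (x ++ b ∷ replicate r′ a) ≡ true → σ (x ++ a ∷ replicate s′ a) ≡ true
      to t with hit b (replicate r′ a) t
      ... | n , eq with long-window x b (replicate r′ a) (length-replicate r′) n eq
      ...   | m , x≡prefix , _ = Equivalence.from (supp _)
                (m , trans (cong (_++ replicate (suc s′) a) x≡prefix) (sym (support≡ m)))
      from : σ (x ++ a ∷ replicate s′ a) ≡ true → σ (x ++ b ∷ replicate r′ a) ≡ true
      from t with hit a (replicate s′ a) t
      ... | n , eq with short-window x a (replicate s′ a) (length-replicate s′) n eq
      ...   | x≡prefix , _ = Equivalence.from (supp _)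
                (suc n , trans (cong (_++ b ∷ replicate r′ a) x≡prefix) (sym (support-suc n)))

  Vanishes-high : ∀ σ → (∀ w → (σ w ≡ true) ⇔ (∃ λ n → w ≡ support n)) →
                  Vanishes (suc r′) (suc s′) σ
  Vanishes-high σ supp x a = cong₂ _xor_
    (trans (sumPar-snoc σ x a r′) (long-a σ supp x))
    (trans (sumPar-snoc σ x b s′) (short-b σ supp x))
  Vanishes-high σ supp x b = begin
    P (suc r′) (suc s′) σ x b
      ≡⟨ cong₂ _xor_ (trans (sumPar-snoc σ x b r′) (long-b σ supp x))
                     (trans (sumPar-snoc σ x a s′) (short-a σ supp x)) ⟩
    σ (x ++ b ∷ replicate r′ a) xor σ (x ++ a ∷ replicate s′ a)
      ≡⟨ cong (_xor σ (x ++ a ∷ replicate s′ a)) (long-b≡short-a σ supp x) ⟩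
    σ (x ++ a ∷ replicate s′ a) xor σ (x ++ a ∷ replicate s′ a)
      ≡⟨ xor-same (σ (x ++ a ∷ replicate s′ a)) ⟩
    false ∎

Vanishes-pinkGenerator : ∀ r′ s′ → s′ < r′ → (α : Fin (suc r′) → Aut) →
  IsPinkGenerators (suc r′) (suc s′) α → ∀ k → Vanishes (suc r′) (suc s′) (α k)
Vanishes-pinkGenerator r′ s′ s′<r′ α gens k with suc (toℕ k) ≤? suc s′
... | yes low = Vanishes-shallow (suc r′) (suc s′) (α k) (toℕ k) low (s≤s (<⇒≤ s′<r′)) deep
  where
  deep : ∀ z → toℕ k < length z → α k z ≡ false
  deep z lt = ¬-not λ t → <-irrefl (sym (trans (cong length (Equivalence.to (IsPinkGenerators.low gens k low z) t))
                                               (length-replicate (toℕ k)))) lt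
... | no ¬low = HighGenerator.Vanishes-high r′ s′ (toℕ k ∸ suc s′) bound (α k)
                  (IsPinkGenerators.high gens k (≰⇒> ¬low))
  where
  bound : toℕ k ∸ suc s′ + suc s′ ≤ r′
  bound = ≤-trans (≤-reflexive (m∸n+n≡m (≤-pred (≰⇒> ¬low)))) (≤-pred (toℕ<n k))

proposition6p2 : (r s : ℕ) → 1 ≤ s → s < r →
    (α : Fin r → Aut) → IsPinkGenerators r s α →
    (σ : Aut) → PinkGroup r s α σ → B r s σ
proposition6p2 (suc r′) (suc s′) _ (s≤s s′<r′) α gens σ σ∈G =
  (false , λ x → σ-van x a , σ-van x b) , refl
  where
  σ-van : Vanishes (suc r′) (suc s′) σ
  σ-van = Vanishes-closed (suc r′) (suc s′) σ (<⇒≤ (s≤s s′<r′)) λ n →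
    let ws , agree = σ∈G n in
    evalGen α ws ,
    Vanishes-evalGen (suc r′) (suc s′) α (Vanishes-pinkGenerator r′ s′ s′<r′ α gens) ws ,
    agree
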